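{- For every positive integer $n$, $r(3;n) \leq R(P_{n+2},P^4_{3n})$.
   Context: $r(3;n)$ is the smallest $N$ such that every coloring of the edges of the complete graph $K_N$ with $n$ colors contains a monochromatic triangle. An ordered 3-uniform hypergraph is a 3-uniform hypergraph with a totally ordered vertex set; $K^{(3)}_N$ is the complete ordered 3-uniform hypergraph on $[N]=\{1,\dots,N\}$ with the natural order. In a red-blue coloring of the triples of $[N]$, an ordered hypergraph $H$ appears as a red (resp. blue) copy if there is an order-preserving injection $V(H)\to[N]$ sending every edge of $H$ to a red (resp. blue) triple. The monotone path $P_k$ has vertex set $\{1,\dots,k\}$ and edges all consecutive triples $(i,i+1,i+2)$. For $t\ge 3$, the power path $P^t_k$ is the ordered 3-uniform hypergraph on $\{1,\dots,k\}$ in which every set of $t$ consecutive vertices spans a complete 3-uniform hypergraph, i.e. its edges are all triples $i<j<l$ with $l-i\le t-1$. For ordered 3-uniform hypergraphs $F,G$, $R(F,G)$ is the smallest $N$ such that every red-blue coloring of the triples of $K^{(3)}_N$ contains a red copy of $F$ or a blue copy of $G$. -}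

module Defs where

open import Data.Nat as ℕ using (ℕ; suc; _∸_)
open import Data.Fin using (Fin; toℕ; _<_)
open import Data.Bool using (Bool; true; false)
open import Data.Product using (Σ; _×_; ∃-syntax)
open import Data.Sum using (_⊎_)
open import Relation.Binary.PropositionalEquality using (_≡_)

IsLeast : (ℕ → Set) → ℕ → Set
IsLeast P N = P N × (∀ M → P M → N ℕ.≤ M)

-- An edge-colouring of K_N with n colours: the colour of edge {i,j}, i<j,
-- is c i j (values with i ≥ j are irrelevant).
-- Every such colouring contains a monochromatic triangle:
TriangleProp : ℕ → ℕ → Set
TriangleProp n N =
  (c : Fin N → Fin N → Fin n) →
  ∃[ i ] ∃[ j ] ∃[ k ] (i < j × j < k × c i j ≡ c i k × c i j ≡ c j k)

-- Ordered 3-uniform hypergraph on vertex set Fin size (natural order).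
-- Edge i j l is only meant for i < j < l.
record OrdHyp : Set₁ where
  field
    size : ℕ
    Edge : Fin size → Fin size → Fin size → Set

MonotonePath : ℕ → OrdHyp
MonotonePath k = record
  { size = k
  ; Edge = λ i j l → toℕ j ≡ suc (toℕ i) × toℕ l ≡ suc (toℕ j) }

PowerPath : ℕ → ℕ → OrdHyp
PowerPath t k = record
  { size = k
  ; Edge = λ i j l → i < j × j < l × (toℕ l ∸ toℕ i) ℕ.≤ (t ∸ 1) }

-- A red-blue colouring of triples of [N]: χ i j l for i<j<l (true = red,
-- false = blue).
HasCopy : (N : ℕ) → (Fin N → Fin N → Fin N → Bool) → Bool → OrdHyp → Set
HasCopy N χ b H =
  Σ (Fin (OrdHyp.size H) → Fin N) λ f →
    (∀ x y → x < y → f x < f y) ×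
    (∀ x y z → OrdHyp.Edge H x y z → χ (f x) (f y) (f z) ≡ b)

HypRamseyProp : OrdHyp → OrdHyp → ℕ → Set
HypRamseyProp F G N =
  (χ : Fin N → Fin N → Fin N → Bool) → HasCopy N χ true F ⊎ HasCopy N χ false G

{-# OPTIONS --safe #-}
-- Let c be an n-colouring of the edges of K_R without monochromatic triangle, and colour a
-- triple a < b < d red iff c(ab) < c(bd).  Along a red monotone path on n + 2 vertices the
-- colours of consecutive edges increase strictly n + 1 times, which n colours cannot afford.
-- Along a blue P⁴ on v₀ < … < v₃ₙ₋₁ the colours xᵢ = c(vᵢvᵢ₊₁) never increase and drop
-- strictly over every three steps, since otherwise xᵢ₊₁ = xᵢ₊₂ = c(vᵢ₊₁vᵢ₊₃) would close a
-- monochromatic triangle.  The same squeeze at the two ends gives x₂ ≤ n − 2 and x₃ₙ₋₄ ≥ 1,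
-- leaving too few colours for the n − 2 drops in between.
module Submission where

open import Defs
open import Data.Nat as ℕ using (ℕ; zero; suc; _≤_; _<_; _+_; _*_; z≤n; s≤s)
open import Data.Nat.Properties
open import Data.Fin as Fin using (Fin; toℕ)
open import Data.Fin.Properties using (toℕ-injective; toℕ<n; any?)
  renaming (_<?_ to _<ᶠ?_; _≟_ to _≟ᶠ_)
open import Data.Bool using (Bool; true; false; T)
open import Data.Unit using (tt)
open import Data.Product using (_×_; _,_; ∃-syntax)
open import Data.Sum using (inj₁; inj₂)
open import Data.Empty using (⊥; ⊥-elim)
open import Relation.Nullary using (¬_; Dec; yes; no; _×-dec_)
open import Relation.Binary.PropositionalEquality using (_≡_; refl; sym; trans; cong; subst; subst₂)

MonochromaticTriangle : ∀ {n N} → (Fin N → Fin N → Fin n) → Set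
MonochromaticTriangle c =
  ∃[ i ] ∃[ j ] ∃[ k ] (i Fin.< j × j Fin.< k × c i j ≡ c i k × c i j ≡ c j k)

monochromaticTriangle? : ∀ {n N} (c : Fin N → Fin N → Fin n) → Dec (MonochromaticTriangle c)
monochromaticTriangle? c = any? λ i → any? λ j → any? λ k →
  (i <ᶠ? j) ×-dec (j <ᶠ? k) ×-dec (c i j ≟ᶠ c i k) ×-dec (c i j ≟ᶠ c j k)

ascentColouring : ∀ {n R} → (Fin R → Fin R → Fin n) → Fin R → Fin R → Fin R → Bool
ascentColouring c a b d = toℕ (c a b) ℕ.<ᵇ toℕ (c b d)

module _ {n R} (c : Fin R → Fin R → Fin n) {a b d : Fin R} where

  ascentColouring-true : ascentColouring c a b d ≡ true → c a b Fin.< c b d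
  ascentColouring-true red = <ᵇ⇒< _ _ (subst T (sym red) tt)

  ascentColouring-false : ascentColouring c a b d ≡ false → c b d Fin.≤ c a b
  ascentColouring-false blue = ≮⇒≥ λ ascent → subst T blue (<⇒<ᵇ ascent)

-- Edge colourings of an initial segment [0, len) of ℕ, with colour col a b for a < b.

TriangleFree : ℕ → (ℕ → ℕ → ℕ) → Set
TriangleFree len col = ∀ {a b d} → a < b → b < d → d < len →
  col a b ≡ col a d → col a b ≡ col b d → ⊥

AscendsAlongPath : ℕ → (ℕ → ℕ → ℕ) → Set
AscendsAlongPath len col = ∀ k → 2 + k < len → col k (1 + k) < col (1 + k) (2 + k)

NeverAscendsInWindows : ℕ → (ℕ → ℕ → ℕ) → Set
NeverAscendsInWindows len col = ∀ {a b d} → a < b → b < d → d < len → d ≤ 3 + a →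
  col b d ≤ col a b

increasing⇒≥index : (x : ℕ → ℕ) (n : ℕ) → (∀ k → k < n → x k < x (suc k)) → n ≤ x n
increasing⇒≥index x zero _ = z≤n
increasing⇒≥index x (suc n) increasing =
  ≤-<-trans (increasing⇒≥index x n (λ k k<n → increasing k (m<n⇒m<1+n k<n)))
            (increasing n ≤-refl)

noAscendingPath : ∀ {n col} → (∀ a b → col a b < n) → ¬ AscendsAlongPath (n + 2) col
noAscendingPath {n} {col} bounded ascends =
  n≮n n (≤-<-trans (increasing⇒≥index x n increasing) (bounded n (1 + n)))
  where
  x : ℕ → ℕ
  x k = col k (1 + k)

  increasing : ∀ k → k < n → x k < x (suc k)
  increasing k k<n = ascends k (subst (_< n + 2) (+-comm k 2) (+-monoˡ-< 2 k<n))

module NonAscendingWindows {len col} (triangleFree : TriangleFree len col)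
                           (nonAscending : NeverAscendsInWindows len col) where

  x : ℕ → ℕ
  x i = col i (1 + i)

  y : ℕ → ℕ
  y i = col i (2 + i)

  i<2+i : ∀ i → i < 2 + i
  i<2+i i = m<n⇒m<1+n (n<1+n i)

  x-step : ∀ i → 2 + i < len → x (1 + i) ≤ x i
  x-step i w = nonAscending (n<1+n i) (n<1+n (1 + i)) w (n≤1+n (2 + i))

  y≤x : ∀ i → 3 + i < len → y (1 + i) ≤ x i
  y≤x i w = nonAscending (n<1+n i) (i<2+i (1 + i)) w ≤-refl

  x≤y : ∀ i → 3 + i < len → x (2 + i) ≤ y i
  x≤y i w = nonAscending (i<2+i i) (n<1+n (2 + i)) w ≤-refl

  consecutiveTriangleFree : ∀ i → 2 + i < len → x i ≡ x (1 + i) → y i ≡ x i → ⊥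
  consecutiveTriangleFree i w x-flat y-flat =
    triangleFree (n<1+n i) (n<1+n (1 + i)) w (sym y-flat) x-flat

  -- If x (3 + i) ≥ x i, all colours squeezed between them coincide: a triangle at 1 + i.
  descent : ∀ i → 4 + i < len → x (3 + i) < x i
  descent i w = ≰⇒> flat⇒⊥
    where
    flat⇒⊥ : x i ≤ x (3 + i) → ⊥
    flat⇒⊥ flat = consecutiveTriangleFree (1 + i) (<⇒≤ w)
      (trans x₁≡x₀ (sym x₂≡x₀)) (trans y₁≡x₀ (sym x₁≡x₀))
      where
      pinned : ∀ {v} → x (3 + i) ≤ v → v ≤ x i → v ≡ x i
      pinned x₃≤v v≤x₀ = ≤-antisym v≤x₀ (≤-trans flat x₃≤v)
      x₂≤x₁ : x (2 + i) ≤ x (1 + i)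
      x₂≤x₁ = x-step (1 + i) (<⇒≤ w)
      x₁≤x₀ : x (1 + i) ≤ x i
      x₁≤x₀ = x-step i (<⇒≤ (<⇒≤ w))
      x₃≤x₂ : x (3 + i) ≤ x (2 + i)
      x₃≤x₂ = x-step (2 + i) w
      x₁≡x₀ : x (1 + i) ≡ x i
      x₁≡x₀ = pinned (≤-trans x₃≤x₂ x₂≤x₁) x₁≤x₀
      x₂≡x₀ : x (2 + i) ≡ x i
      x₂≡x₀ = pinned x₃≤x₂ (≤-trans x₂≤x₁ x₁≤x₀)
      y₁≡x₀ : y (1 + i) ≡ x i
      y₁≡x₀ = pinned (x≤y (1 + i) w) (y≤x i (<⇒≤ w))

  descents : ∀ k i → 1 + (k * 3 + i) < len → x (k * 3 + i) + k ≤ x i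
  descents zero i _ = ≤-reflexive (+-identityʳ (x i))
  descents (suc k) i w = begin
    x (3 + j) + suc k  ≡⟨ +-suc (x (3 + j)) k ⟩
    suc (x (3 + j)) + k ≤⟨ +-monoˡ-≤ k (descent j w) ⟩
    x j + k            ≤⟨ descents k i (m+n≤o⇒n≤o 3 w) ⟩
    x i                ∎
    where
    open ≤-Reasoning
    j = k * 3 + i

  2+x₂≤n : ∀ {n} → (∀ a b → col a b < n) → 3 < len → 2 + x 2 ≤ n
  2+x₂≤n {n} bounded w = ≰⇒> flat⇒⊥
    where
    squeeze : ∀ {v} → x 2 ≤ v → v < n → n ≤ suc (x 2) → v ≡ x 2
    squeeze x₂≤v v<n n≤1+x₂ = ≤-antisym (≤-pred (≤-trans v<n n≤1+x₂)) x₂≤v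
    flat⇒⊥ : n ≤ suc (x 2) → ⊥
    flat⇒⊥ n≤1+x₂ = consecutiveTriangleFree 0 (<⇒≤ w)
      (trans x₀≡x₂ (sym (squeeze (x-step 1 w) (bounded 1 2) n≤1+x₂)))
      (trans (squeeze (x≤y 0 w) (bounded 0 2) n≤1+x₂) (sym x₀≡x₂))
      where
      x₀≡x₂ : x 0 ≡ x 2
      x₀≡x₂ = squeeze (≤-trans (x-step 1 w) (x-step 0 (<⇒≤ w))) (bounded 0 1) n≤1+x₂

  x-positive : ∀ j → 3 + j < len → 0 < x j
  x-positive j w = n≢0⇒n>0 zero⇒⊥
    where
    zero⇒⊥ : x j ≡ 0 → ⊥
    zero⇒⊥ xⱼ≡0 = consecutiveTriangleFree (1 + j) w
      (trans (below x₁≤x₀) (sym (below (≤-trans (x-step (1 + j) w) x₁≤x₀))))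
      (trans (below (y≤x j w)) (sym (below x₁≤x₀)))
      where
      below : ∀ {v} → v ≤ x j → v ≡ 0
      below v≤xⱼ = n≤0⇒n≡0 (subst (_ ≤_) xⱼ≡0 v≤xⱼ)
      x₁≤x₀ : x (1 + j) ≤ x j
      x₁≤x₀ = x-step j (<⇒≤ w)

  noLongPath : ∀ {n} → (∀ a b → col a b < n) → 3 * n ≤ len → ⊥
  noLongPath {zero} bounded _ = n≮0 (bounded 0 0)
  noLongPath {1} bounded long =
    consecutiveTriangleFree 0 long (trans (colour0 0 1) (sym (colour0 1 2)))
                                   (trans (colour0 0 2) (sym (colour0 0 1)))
    where
    colour0 : ∀ a b → col a b ≡ 0
    colour0 a b = n<1⇒n≡0 (bounded a b)
  noLongPath {suc (suc m)} bounded long =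
    1+n≰n (≤-trans (s≤s (s≤s 1+m≤x₂)) (2+x₂≤n bounded (m+n≤o⇒m≤o 4 window)))
    where
    open ≤-Reasoning
    j = m * 3 + 2
    window : 4 + j ≤ len
    window = subst (_≤ len) (trans (*-comm 3 (2 + m)) (cong (4 +_) (+-comm 2 (m * 3)))) long
    1+m≤x₂ : 1 + m ≤ x 2
    1+m≤x₂ = begin
      1 + m ≤⟨ +-monoˡ-≤ m (x-positive j window) ⟩
      x j + m ≤⟨ descents m 2 (m+n≤o⇒n≤o 2 window) ⟩
      x 2 ∎

clamp : (M : ℕ) → ℕ → Fin (suc M)
clamp M zero = Fin.zero
clamp zero (suc k) = Fin.zero
clamp (suc M) (suc k) = Fin.suc (clamp M k)

toℕ-clamp : ∀ M k → k < suc M → toℕ (clamp M k) ≡ k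
toℕ-clamp M zero _ = refl
toℕ-clamp zero (suc k) (s≤s ())
toℕ-clamp (suc M) (suc k) (s≤s k<1+M) = cong suc (toℕ-clamp M k k<1+M)

-- c read along the copy f, indexed by ℕ; positions beyond M are clamped and never used.
module CopyColouring {n R M} (c : Fin R → Fin R → Fin n) (f : Fin (suc M) → Fin R)
                     (f-mono : ∀ x y → x Fin.< y → f x Fin.< f y) where

  vertex : ℕ → Fin R
  vertex k = f (clamp M k)

  colour : ℕ → ℕ → ℕ
  colour k l = toℕ (c (vertex k) (vertex l))

  colour-bounded : ∀ a b → colour a b < n
  colour-bounded a b = toℕ<n _

  clamp-mono : ∀ {a b} → a < b → b < suc M → clamp M a Fin.< clamp M b
  clamp-mono {a} {b} a<b b<1+M =
    subst₂ _<_ (sym (toℕ-clamp M a (<-trans a<b b<1+M))) (sym (toℕ-clamp M b b<1+M)) a<b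

  clamp-suc : ∀ {k} → suc k < suc M → toℕ (clamp M (suc k)) ≡ suc (toℕ (clamp M k))
  clamp-suc {k} w = trans (toℕ-clamp M (suc k) w) (cong suc (sym (toℕ-clamp M k (<⇒≤ w))))

  triangleFree : ¬ MonochromaticTriangle c → TriangleFree (suc M) colour
  triangleFree noTriangle a<b b<d d<1+M ab≡ad ab≡bd =
    noTriangle (_ , _ , _ , f-mono _ _ (clamp-mono a<b (<-trans b<d d<1+M)) ,
                f-mono _ _ (clamp-mono b<d d<1+M) , toℕ-injective ab≡ad , toℕ-injective ab≡bd)

  ascends : (∀ x y z → OrdHyp.Edge (MonotonePath (suc M)) x y z →
               ascentColouring c (f x) (f y) (f z) ≡ true) →
            AscendsAlongPath (suc M) colour
  ascends red k w = ascentColouring-true c (red _ _ _ (clamp-suc (<⇒≤ w) , clamp-suc w))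

  neverAscends : (∀ x y z → OrdHyp.Edge (PowerPath 4 (suc M)) x y z →
                    ascentColouring c (f x) (f y) (f z) ≡ false) →
                 NeverAscendsInWindows (suc M) colour
  neverAscends blue {a} {b} {d} a<b b<d d<1+M d≤3+a = ascentColouring-false c (blue _ _ _
    ( clamp-mono a<b (<-trans b<d d<1+M)
    , clamp-mono b<d d<1+M
    , subst₂ (λ l i → l ℕ.∸ i ≤ 3) (sym (toℕ-clamp M d d<1+M))
             (sym (toℕ-clamp M a (<-trans a<b (<-trans b<d d<1+M))))
             (m≤n+o⇒m∸n≤o d a (subst (d ≤_) (+-comm 3 a) d≤3+a))))

hypRamsey⇒triangle : ∀ m R →
  HypRamseyProp (MonotonePath (suc m + 2)) (PowerPath 4 (3 * suc m)) R → TriangleProp (suc m) R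
hypRamsey⇒triangle m R ramsey c with monochromaticTriangle? c
... | yes triangle = triangle
... | no noTriangle with ramsey (ascentColouring c)
...   | inj₁ (f , f-mono , red) = ⊥-elim (noAscendingPath colour-bounded (ascends red))
  where open CopyColouring c f f-mono
...   | inj₂ (f , f-mono , blue) =
  ⊥-elim (noLongPath colour-bounded ≤-refl)
  where
  open CopyColouring c f f-mono
  open NonAscendingWindows (triangleFree noTriangle) (neverAscends blue)

mainTheorem2 : (n : ℕ) → 1 ≤ n → (r R : ℕ) →
    IsLeast (TriangleProp n) r →
    IsLeast (HypRamseyProp (MonotonePath (n + 2)) (PowerPath 4 (3 * n))) R →
    r ≤ R
mainTheorem2 (suc m) _ r R (_ , r-least) (ramsey , _) = r-least R (hypRamsey⇒triangle m R ramsey)
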